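{- Let $A,B$ be infinite sets of nonnegative integers such that $r_{A,B}(n)=1$ for every nonnegative integer $n$. Then $d_{A,B}(n)=1$ for every integer $n$.
   Context: For nonempty sets $A,B$ of nonnegative integers and an integer $n$, $r_{A,B}(n)$ denotes the number of pairs $(a,b)\in A\times B$ with $a+b=n$, and $d_{A,B}(n)$ denotes the number of pairs $(a,b)\in A\times B$ with $a-b=n$. -}

module Defs where

open import Data.Nat using (ℕ; _+_; _≥_)
open import Data.Integer using (ℤ; +_; _-_)
open import Data.Product using (Σ; _×_; _,_; ∃)
open import Relation.Binary.PropositionalEquality using (_≡_)

SetOfℕ : Set₁
SetOfℕ = ℕ → Set

Infinite : SetOfℕ → Set
Infinite A = ∀ m → ∃ λ a → a ≥ m × A a

ExactlyOnePair : SetOfℕ → SetOfℕ → (ℕ → ℕ → Set) → Set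
ExactlyOnePair A B P =
  Σ (ℕ × ℕ) λ { (a , b) →
    (A a × B b × P a b) ×
    (∀ a' b' → A a' → B b' → P a' b' → (a' ≡ a × b' ≡ b)) }

r≡1 : SetOfℕ → SetOfℕ → ℕ → Set
r≡1 A B n = ExactlyOnePair A B (λ a b → a + b ≡ n)

d≡1 : SetOfℕ → SetOfℕ → ℤ → Set
d≡1 A B n = ExactlyOnePair A B (λ a b → (+ a) - (+ b) ≡ n)

-- Let m be the least positive element of the summand not containing 1, say B.
-- Then [0, m) ⊆ A, and by induction on q·m + r the set A is a union of whole
-- blocks [q·m, q·m + m) while B consists of multiples of m; hence A/m and B/m
-- (elements divided by m) again form an infinite complementary pair.  Every
-- natural number n is then a difference a − b, and so is −n: reduce n modulo m
-- and recurse on the quotient, which is smaller than n because m ≥ 2.  Unique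
-- representability of a + b' turns existence of differences into uniqueness.
module Submission where

open import Defs
open import Data.Nat.Base
open import Data.Nat.Properties
open import Data.Nat.DivMod
open import Data.Nat.Induction using (<-rec)
open import Data.Nat.Tactic.RingSolver using (solve-∀)
open import Data.Integer.Base as ℤ using (ℤ; +_; -[1+_])
import Data.Integer.Properties as ℤ
import Data.Integer.Tactic.RingSolver as ℤ-Solver
open import Data.Product
open import Data.Sum.Base using (_⊎_; inj₁; inj₂)
open import Data.Empty using (⊥-elim)
open import Relation.Nullary using (¬_; yes; no; contradiction)
open import Relation.Unary using (Decidable)
open import Function.Base using (_∘_)
open import Relation.Binary.PropositionalEquality

least-witness : ∀ {p} {P : ℕ → Set p} → Decidable P → ∀ {n} → P n →
                ∃ λ k → P k × (∀ {j} → j < k → ¬ P j)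
least-witness P? {n} Pn with P? 0
... | yes P0 = 0 , P0 , λ ()
least-witness P? {zero}  P0 | no ¬P0 = ⊥-elim (¬P0 P0)
least-witness P? {suc n} Pn | no ¬P0 with least-witness (λ k → P? (suc k)) Pn
... | k , Pk , least = suc k , Pk , λ { {zero} _ → ¬P0 ; {suc j} j<k → least (s<s⁻¹ j<k) }

+-*-rearrange : ∀ d j m r → d * m + r + j * m ≡ (d + j) * m + r
+-*-rearrange = solve-∀

quot-rem : ∀ n m .{{_ : NonZero m}} → n ≡ n / m * m + n % m
quot-rem n m = trans (m≡m%n+[m/n]*n n m) (+-comm (n % m) (n / m * m))

quot-rem-unique : ∀ m .{{_ : NonZero m}} q q' {r r'} → r < m → r' < m →
                  q * m + r ≡ q' * m + r' → q ≡ q' × r ≡ r'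
quot-rem-unique m q q' {r} {r'} r<m r'<m eq =
  *-cancelʳ-≡ q q' m (+-cancelʳ-≡ r (q * m) (q' * m) (subst (λ t → q * m + r ≡ q' * m + t) (sym r≡r') eq)) ,
  r≡r'
  where
  open ≡-Reasoning
  r≡r' : r ≡ r'
  r≡r' = begin
    r                 ≡⟨ m<n⇒m%n≡m r<m ⟨
    r % m             ≡⟨ [m+kn]%n≡m%n r q m ⟨
    (r + q * m) % m   ≡⟨ cong (_% m) (trans (+-comm r (q * m)) (trans eq (+-comm (q' * m) r'))) ⟩
    (r' + q' * m) % m ≡⟨ [m+kn]%n≡m%n r' q' m ⟩
    r' % m            ≡⟨ m<n⇒m%n≡m r'<m ⟩
    r'                ∎

split-off-multiple : ∀ m .{{_ : NonZero m}} {a} j q {s} → a + j * m ≡ q * m + s → s < m →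
                     ∃ λ d → a ≡ d * m + s × d + j ≡ q
split-off-multiple m {a} j q {s} eq s<m with quot-rem-unique m (a / m + j) q (m%n<n a m) s<m eq′
  where
  open ≡-Reasoning
  eq′ : (a / m + j) * m + a % m ≡ q * m + s
  eq′ = begin
    (a / m + j) * m + a % m   ≡⟨ +-*-rearrange (a / m) j m (a % m) ⟨
    a / m * m + a % m + j * m ≡⟨ cong (_+ j * m) (quot-rem a m) ⟨
    a + j * m                 ≡⟨ eq ⟩
    q * m + s                 ∎
... | d+j≡q , a%m≡s = a / m , trans (quot-rem a m) (cong (_+_ (a / m * m)) a%m≡s) , d+j≡q

complement-to-multiple : ∀ n m .{{_ : NonZero m}} → suc n + (m ∸ suc (n % m)) ≡ suc (n / m) * m
complement-to-multiple n m = begin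
  suc n + o                       ≡⟨ cong (λ t → suc t + o) (quot-rem n m) ⟩
  suc (n / m * m + n % m) + o     ≡⟨ rearrange (n / m * m) (n % m) o ⟩
  n / m * m + (o + suc (n % m))   ≡⟨ cong (_+_ (n / m * m)) (m∸n+n≡m (m%n<n n m)) ⟩
  n / m * m + m                   ≡⟨ +-comm (n / m * m) m ⟩
  suc (n / m) * m                 ∎
  where
  open ≡-Reasoning
  o : ℕ
  o = m ∸ suc (n % m)
  rearrange : ∀ x r o → suc (x + r) + o ≡ x + (o + suc r)
  rearrange = solve-∀

Complementary : SetOfℕ → SetOfℕ → Set
Complementary A B = ∀ n → r≡1 A B n

complementary-swap : ∀ {A B} → Complementary A B → Complementary B A
complementary-swap H n with H n
... | (a , b) , (Aa , Bb , a+b≡n) , only =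
  (b , a) , (Bb , Aa , trans (+-comm b a) a+b≡n) ,
  λ b' a' Bb' Aa' b'+a'≡n → swap (only a' b' Aa' Bb' (trans (+-comm a' b') b'+a'≡n))

module ComplementaryPair {A B : SetOfℕ} (H : Complementary A B) where

  representation : ∀ n → ∃₂ λ a b → A a × B b × a + b ≡ n
  representation n with H n
  ... | (a , b) , (Aa , Bb , a+b≡n) , _ = a , b , Aa , Bb , a+b≡n

  unique : ∀ {a b a' b'} → A a → B b → A a' → B b' → a + b ≡ a' + b' → a ≡ a' × b ≡ b'
  unique {a} {b} Aa Bb Aa' Bb' eq with H (a + b)
  ... | _ , _ , only with only _ _ Aa Bb refl | only _ _ Aa' Bb' (sym eq)
  ... | refl , refl | refl , refl = refl , refl

  0∈A : A 0
  0∈A with representation 0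
  ... | a , b , Aa , _ , a+b≡0 = subst A (m+n≡0⇒m≡0 a a+b≡0) Aa

  0∈B : B 0
  0∈B with representation 0
  ... | a , b , _ , Bb , a+b≡0 = subst B (m+n≡0⇒n≡0 a a+b≡0) Bb

  A∩B⇒≡0 : ∀ {x} → A x → B x → x ≡ 0
  A∩B⇒≡0 {x} Ax Bx = proj₁ (unique Ax 0∈B 0∈A Bx (+-comm x 0))

  B? : Decidable B
  B? x with representation x
  ... | a , b , Aa , Bb , a+b≡x with a ≟ 0
  ...   | yes refl = yes (subst B a+b≡x Bb)
  ...   | no a≢0   = no λ Bx → a≢0 (sym (proj₁ (unique 0∈A Bx Aa Bb (sym a+b≡x))))

  1∈A⊎1∈B : A 1 ⊎ B 1
  1∈A⊎1∈B with representation 1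
  ... | zero  , b , _  , Bb , refl = inj₂ Bb
  ... | suc a , b , Aa , _  , 1+a+b≡1 =
    inj₁ (subst A (cong suc (m+n≡0⇒m≡0 a (suc-injective 1+a+b≡1))) Aa)

  least-positive : Infinite B → A 1 → ∃ λ k → B (2 + k) × (∀ {s} → B s → s < 2 + k → s ≡ 0)
  least-positive IB A1 with IB 1
  ... | suc b , _ , Bb with least-witness (λ s → B? (suc s)) Bb
  ...   | zero  , B1 , _     = contradiction (A∩B⇒≡0 A1 B1) λ ()
  ...   | suc k , Bm , least = k , Bm , below
    where
    below : ∀ {s} → B s → s < 2 + k → s ≡ 0
    below {zero}  _  _   = refl
    below {suc s} Bs s<m = ⊥-elim (least (s<s⁻¹ s<m) Bs)

Scaled : ℕ → SetOfℕ → SetOfℕ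
Scaled m X x = X (x * m)

infinite-scaled : ∀ {X} m .{{_ : NonZero m}} →
                  (∀ q {r} → r < m → X (q * m + r) → X (q * m)) →
                  Infinite X → Infinite (Scaled m X)
infinite-scaled {X} m round-down IX k with IX (k * m)
... | x , km≤x , Xx =
  x / m , subst (_≤ x / m) (m*n/n≡m k m) (/-monoˡ-≤ m km≤x) ,
  round-down (x / m) (m%n<n x m) (subst X (quot-rem x m) Xx)

Difference : SetOfℕ → SetOfℕ → ℕ → Set
Difference X Y n = ∃ λ y → Y y × X (n + y)

Difference± : SetOfℕ → SetOfℕ → ℕ → Set
Difference± X Y n = Difference X Y n × Difference Y X n

module Blocks {A B : SetOfℕ} (H : Complementary A B) (m : ℕ) .{{_ : NonZero m}}
              (m∈B : B m) (B-below-m : ∀ {s} → B s → s < m → s ≡ 0) where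

  open ComplementaryPair H

  below-m∈A : ∀ {r} → r < m → A r
  below-m∈A {r} r<m with representation r
  ... | a , b , Aa , Bb , refl with B-below-m Bb (≤-<-trans (m≤n+m b a) r<m)
  ...   | refl = subst A (sym (+-identityʳ a)) Aa

  -- Otherwise (m − r) + (q·m + r) and q·m + m would be two representations.
  A-block∌B : ∀ q {r} → A (q * m) → 0 < r → r < m → ¬ B (q * m + r)
  A-block∌B q {r} Aqm 0<r r<m Bqmr =
    <-irrefl (sym (proj₂ (quot-rem-unique m q 1 r<m (>-nonZero⁻¹ m) qm+r≡1*m+0))) 0<r
    where
    open ≡-Reasoning
    m∸r+qm+r≡qm+m : m ∸ r + (q * m + r) ≡ q * m + m
    m∸r+qm+r≡qm+m = begin
      m ∸ r + (q * m + r) ≡⟨ +-assoc (m ∸ r) (q * m) r ⟨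
      m ∸ r + q * m + r   ≡⟨ cong (_+ r) (+-comm (m ∸ r) (q * m)) ⟩
      q * m + (m ∸ r) + r ≡⟨ +-assoc (q * m) (m ∸ r) r ⟩
      q * m + (m ∸ r + r) ≡⟨ cong (_+_ (q * m)) (m∸n+n≡m (<⇒≤ r<m)) ⟩
      q * m + m           ∎
    qm+r≡1*m+0 : q * m + r ≡ 1 * m + 0
    qm+r≡1*m+0 =
      trans (proj₂ (unique (below-m∈A (∸-monoʳ-< 0<r (<⇒≤ r<m))) Bqmr Aqm m∈B m∸r+qm+r≡qm+m))
            (sym (trans (+-identityʳ (1 * m)) (*-identityˡ m)))

  -- d·m + s together with (1 + j)·m represents q·m + s a second time.
  shifted-block : ∀ {d j q s} → d + suc j ≡ q → A (d * m + s) → B (suc j * m) →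
                  ¬ A (q * m + s) × (B (q * m + s) → s ≡ 0)
  shifted-block {d} {j} {q} {s} d+j≡q Ad Bj = ¬Aq , Bq⇒s≡0
    where
    sum : d * m + s + suc j * m ≡ q * m + s
    sum = trans (+-*-rearrange d (suc j) m s) (cong (λ t → t * m + s) d+j≡q)
    ¬Aq : ¬ A (q * m + s)
    ¬Aq Aq with m*n≡0⇒m≡0 (suc j) m (sym (proj₂ (unique Aq 0∈B Ad Bj (trans (+-identityʳ _) (sym sum)))))
    ... | ()
    Bq⇒s≡0 : B (q * m + s) → s ≡ 0
    Bq⇒s≡0 Bq = m+n≡0⇒n≡0 (d * m) (sym (proj₁ (unique 0∈A Bq Ad Bj (sym sum))))

  BlockShape : ℕ → ℕ → Set
  BlockShape q r = (B (q * m + r) → r ≡ 0) × (A (q * m + r) → A (q * m)) × (A (q * m) → A (q * m + r))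

  BlockShapesBelow : ℕ → Set
  BlockShapesBelow n = ∀ j {s} → s < m → j * m + s < n → BlockShape j s

  multiple-below : ∀ {n b} → BlockShapesBelow n → B b → b < n → ∃ λ j → b ≡ j * m
  multiple-below {n} {b} shapes Bb b<n =
    b / m , trans (quot-rem b m) (trans (cong (_+_ (b / m * m)) rem≡0) (+-identityʳ _))
    where
    rem≡0 : b % m ≡ 0
    rem≡0 = proj₁ (shapes (b / m) (m%n<n b m) (subst (_< n) (quot-rem b m) b<n)) (subst B (quot-rem b m) Bb)

  whole-or-shifted : ∀ {n} q {s} → BlockShapesBelow n → s < m → (∀ {b} → B b → b ≤ q * m + s → b < n) →
                     A (q * m + s) ⊎ ∃₂ λ d j → d + suc j ≡ q × A (d * m + s) × B (suc j * m)
  whole-or-shifted {n} q {s} shapes s<m B-small with representation (q * m + s)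
  ... | a , b , Aa , Bb , a+b≡ with multiple-below shapes Bb (B-small Bb (subst (b ≤_) a+b≡ (m≤n+m b a)))
  ... | j , refl with split-off-multiple m j q a+b≡ s<m
  ... | d , refl , d+j≡q with j
  ...   | zero  = inj₁ (subst (λ t → A (t * m + s)) (trans (sym (+-identityʳ d)) d+j≡q) Aa)
  ...   | suc j = inj₂ (d , j , d+j≡q , Aa , Bb)

  shift-< : ∀ {d j q} r → d + suc j ≡ q → d * m + r < q * m + r
  shift-< {d} r d+j≡q = +-monoˡ-< r (*-monoˡ-< m (subst (d <_) d+j≡q (m<m+n d z<s)))

  blockShape-step : ∀ q r → r < m → BlockShapesBelow (q * m + r) → BlockShape q r
  blockShape-step q zero _ _ = (λ _ → refl) , subst A (+-identityʳ _) , subst A (sym (+-identityʳ _))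
  blockShape-step q r@(suc _) r<m shapes
    with whole-or-shifted q shapes (>-nonZero⁻¹ m) (λ _ b≤qm → ≤-<-trans b≤qm (+-monoʳ-< (q * m) z<s))
  ... | inj₁ Aqm0 = ⊥-elim ∘ ¬Bqmr , (λ _ → Aqm) , (λ _ → Aqmr)
    where
    Aqm : A (q * m)
    Aqm = subst A (+-identityʳ _) Aqm0
    ¬Bqmr : ¬ B (q * m + r)
    ¬Bqmr = A-block∌B q Aqm z<s r<m
    Aqmr : A (q * m + r)
    Aqmr with whole-or-shifted q shapes r<m (λ Bb b≤ → ≤∧≢⇒< b≤ λ { refl → ¬Bqmr Bb })
    ... | inj₁ Aqmr = Aqmr
    ... | inj₂ (d , j , d+j≡q , Adr , Bjm) =
      ⊥-elim (proj₁ (shifted-block d+j≡q Ad0 Bjm) Aqm0)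
      where
      Ad0 : A (d * m + 0)
      Ad0 = subst A (sym (+-identityʳ _)) (proj₁ (proj₂ (shapes d r<m (shift-< r d+j≡q))) Adr)
  ... | inj₂ (d , j , d+j≡q , Ad0 , Bjm) =
    proj₂ shadowed , ⊥-elim ∘ proj₁ shadowed ,
    ⊥-elim ∘ proj₁ (shifted-block d+j≡q Ad0 Bjm) ∘ subst A (sym (+-identityʳ _))
    where
    Adr : A (d * m + r)
    Adr = proj₂ (proj₂ (shapes d r<m (shift-< r d+j≡q))) (subst A (+-identityʳ _) Ad0)
    shadowed : ¬ A (q * m + r) × (B (q * m + r) → r ≡ 0)
    shadowed = shifted-block d+j≡q Adr Bjm

  blockShape : ∀ q r → r < m → BlockShape q r
  blockShape q r r<m = <-rec Motive step (q * m + r) q refl r<m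
    where
    Motive : ℕ → Set
    Motive n = ∀ q {r} → q * m + r ≡ n → r < m → BlockShape q r
    step : ∀ n → (∀ {n'} → n' < n → Motive n') → Motive n
    step _ shapes q refl r<m = blockShape-step q _ r<m (λ j s<m lt → shapes lt j refl s<m)

  B-multiple : ∀ {b} → B b → ∃ λ j → b ≡ j * m
  B-multiple {b} Bb = multiple-below (λ j s<m _ → blockShape j _ s<m) Bb (n<1+n b)

  A-round-down : ∀ q {r} → r < m → A (q * m + r) → A (q * m)
  A-round-down q r<m = proj₁ (proj₂ (blockShape q _ r<m))

  A-round-up : ∀ q {r} → r < m → A (q * m) → A (q * m + r)
  A-round-up q r<m = proj₂ (proj₂ (blockShape q _ r<m))

  B-round-down : ∀ q {r} → r < m → B (q * m + r) → B (q * m)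
  B-round-down q r<m Bqmr with proj₁ (blockShape q _ r<m) Bqmr
  ... | refl = subst B (+-identityʳ _) Bqmr

  complementary-scaled : Complementary (Scaled m A) (Scaled m B)
  complementary-scaled n with representation (n * m)
  ... | a , b , Aa , Bb , a+b≡nm with B-multiple Bb
  ... | j , refl with split-off-multiple m j n (trans a+b≡nm (sym (+-identityʳ _))) (>-nonZero⁻¹ m)
  ... | d , refl , d+j≡n = (d , j) , (Adm , Bb , d+j≡n) , only
    where
    Adm : A (d * m)
    Adm = subst A (+-identityʳ _) Aa
    only : ∀ d' j' → A (d' * m) → B (j' * m) → d' + j' ≡ n → d' ≡ d × j' ≡ j
    only d' j' Ad'm Bj'm d'+j'≡n with unique Ad'm Bj'm Adm Bb (begin
        d' * m + j' * m ≡⟨ *-distribʳ-+ m d' j' ⟨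
        (d' + j') * m   ≡⟨ cong (_* m) (trans d'+j'≡n (sym d+j≡n)) ⟩
        (d + j) * m     ≡⟨ *-distribʳ-+ m d j ⟩
        d * m + j * m   ∎)
      where open ≡-Reasoning
    ... | d'm≡dm , j'm≡jm = *-cancelʳ-≡ d' d m d'm≡dm , *-cancelʳ-≡ j' j m j'm≡jm

  lift-difference : ∀ q {r} → r < m → Difference (Scaled m A) (Scaled m B) q → Difference A B (q * m + r)
  lift-difference q {r} r<m (y , Bym , Aq+ym) =
    y * m , Bym , subst A (sym (+-*-rearrange q y m r)) (A-round-up (q + y) r<m Aq+ym)

  lift-difference⁻ : ∀ {n o} q → o < m → n + o ≡ q * m →
                     Difference (Scaled m B) (Scaled m A) q → Difference B A n
  lift-difference⁻ {n} {o} q o<m n+o≡qm (x , Axm , Bq+xm) =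
    x * m + o , A-round-up x o<m Axm , subst B q+x*m≡n+xm+o Bq+xm
    where
    open ≡-Reasoning
    q+x*m≡n+xm+o : (q + x) * m ≡ n + (x * m + o)
    q+x*m≡n+xm+o = begin
      (q + x) * m     ≡⟨ *-distribʳ-+ m q x ⟩
      q * m + x * m   ≡⟨ cong (_+ x * m) n+o≡qm ⟨
      n + o + x * m   ≡⟨ +-assoc n o (x * m) ⟩
      n + (o + x * m) ≡⟨ cong (_+_ n) (+-comm o (x * m)) ⟩
      n + (x * m + o) ∎

  difference-one : Difference (Scaled m B) (Scaled m A) 1
  difference-one = 0 , 0∈A , subst B (sym (+-identityʳ m)) m∈B

DifferencesOf : ℕ → Set₁
DifferencesOf n = ∀ {X Y} → Complementary X Y → Infinite X → Infinite Y → Difference± X Y n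

difference±-if-1∈X : ∀ n → (∀ {j} → j < suc n → DifferencesOf j) →
                     ∀ {X Y} → Complementary X Y → Infinite X → Infinite Y → X 1 → Difference± X Y (suc n)
difference±-if-1∈X n differences {X} {Y} H IX IY X1 with ComplementaryPair.least-positive H IY X1
... | k , m∈Y , Y-below-m =
  subst (Difference X Y) (sym (quot-rem (suc n) m))
        (lift-difference (suc n / m) (m%n<n (suc n) m) (proj₁ (scaled (m/n<m (suc n) m 1<m)))) ,
  lift-difference⁻ (suc (n / m)) (∸-monoʳ-< z<s (m%n<n n m)) (complement-to-multiple n m) (scaled-down n ≤-refl)
  where
  m : ℕ
  m = 2 + k
  1<m : 1 < m
  1<m = s<s z<s
  open Blocks H m m∈Y Y-below-m
  scaled : ∀ {j} → j < suc n → Difference± (Scaled m X) (Scaled m Y) j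
  scaled j<n = differences j<n complementary-scaled
                 (infinite-scaled m A-round-down IX) (infinite-scaled m B-round-down IY)
  scaled-down : ∀ j → j ≤ n → Difference (Scaled m Y) (Scaled m X) (suc (j / m))
  -- For n = 0 the quotient does not decrease; 1 = m/m − 0 is read off m ∈ Y.
  scaled-down zero    _     = difference-one
  scaled-down (suc j) 1+j≤n = proj₂ (scaled (s<s (<-≤-trans (m/n<m (suc j) m 1<m) 1+j≤n)))

every-difference± : ∀ n → DifferencesOf n
every-difference± = <-rec DifferencesOf step
  where
  step : ∀ n → (∀ {j} → j < n → DifferencesOf j) → DifferencesOf n
  step zero    _           H _  _  = (0 , 0∈B , 0∈A) , (0 , 0∈A , 0∈B)
    where open ComplementaryPair H
  step (suc n) differences H IX IY with ComplementaryPair.1∈A⊎1∈B H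
  ... | inj₁ X1 = difference±-if-1∈X n differences H IX IY X1
  ... | inj₂ Y1 = swap (difference±-if-1∈X n differences (complementary-swap H) IY IX Y1)

difference-cross : ∀ a b c d → + a ℤ.- + b ≡ + c ℤ.- + d → a + d ≡ c + b
difference-cross a b c d eq = ℤ.+-injective (begin
  + (a + d)                       ≡⟨ cancel (+ a) (+ b) (+ d) ⟨
  + a ℤ.- + b ℤ.+ (+ b ℤ.+ + d)   ≡⟨ cong₂ ℤ._+_ eq (ℤ.+-comm (+ b) (+ d)) ⟩
  + c ℤ.- + d ℤ.+ (+ d ℤ.+ + b)   ≡⟨ cancel (+ c) (+ d) (+ b) ⟩
  + (c + b)                       ∎)
  where
  open ≡-Reasoning
  cancel : ∀ x y z → x ℤ.- y ℤ.+ (y ℤ.+ z) ≡ x ℤ.+ z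
  cancel = ℤ-Solver.solve-∀

d≡1-intro : ∀ {A B} → Complementary A B → ∀ {a b n} → A a → B b → + a ℤ.- + b ≡ n → d≡1 A B n
d≡1-intro {A} {B} H {a} {b} {n} Aa Bb a-b≡n = (a , b) , (Aa , Bb , a-b≡n) , only
  where
  open ComplementaryPair H
  only : ∀ a' b' → A a' → B b' → + a' ℤ.- + b' ≡ n → a' ≡ a × b' ≡ b
  only a' b' Aa' Bb' a'-b'≡n with unique Aa' Bb Aa Bb' (difference-cross a' b' a b (trans a'-b'≡n (sym a-b≡n)))
  ... | refl , refl = refl , refl

theorem2 : (A B : SetOfℕ) → Infinite A → Infinite B →
    (∀ (n : ℕ) → r≡1 A B n) →
    ∀ (n : ℤ) → d≡1 A B n
theorem2 A B IA IB H (+ n) with proj₁ (every-difference± n H IA IB)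
... | b , Bb , An+b = d≡1-intro H An+b Bb (n+b-b≡n (+ n) (+ b))
  where
  n+b-b≡n : ∀ x y → x ℤ.+ y ℤ.- y ≡ x
  n+b-b≡n = ℤ-Solver.solve-∀
theorem2 A B IA IB H -[1+ n ] with proj₂ (every-difference± (suc n) H IA IB)
... | a , Aa , B1+n+a = d≡1-intro H Aa B1+n+a (a-[n+a]≡-n (+ a) (+ suc n))
  where
  a-[n+a]≡-n : ∀ x y → x ℤ.- (y ℤ.+ x) ≡ ℤ.- y
  a-[n+a]≡-n = ℤ-Solver.solve-∀
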